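{- No path in $\Gamma(p,e)$ contains $UUDD$ as a subpath; that is, there are no vertices $x,a,z,b,y$ such that $x\to a$ and $a\to z$ are $U$-edges and $z\to b$ and $b\to y$ are $D$-edges.
   Context: Let $p$ be a prime and $e\ge2$ an integer. For integers $r\ge 2$, let $S(p,e,r)$ be the smallest set $S$ of positive integers such that $r\in S$; $n\in S$ whenever $n^e\in S$; and $(n+p)^e\in S$ whenever $n\in S$. Let $\Gamma(p,e)$ be the directed graph with vertex set $V=\bigcup_{r\ge2}S(p,e,r)$, $U$-edges $(n,(n+p)^e)$ for $n\in V$, and $D$-edges $(n^e,n)$ for $n\in V$. A path is a directed walk, recorded as a word in $U$ and $D$. -}

module Defs where

open import Data.Nat using (ℕ; _+_; _^_; _≤_)
open import Data.Product using (Σ; _×_)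
open import Relation.Binary.PropositionalEquality using (_≡_)

-- S p e r : the smallest set of positive integers containing r,
-- closed under  n^e ∈ S ⇒ n ∈ S  and  n ∈ S ⇒ (n+p)^e ∈ S.
-- (Inductive predicate = smallest such set.)
data S (p e r : ℕ) : ℕ → Set where
  base : S p e r r
  root : ∀ {n} → S p e r (n ^ e) → S p e r n
  up   : ∀ {n} → S p e r n → S p e r ((n + p) ^ e)

V : ℕ → ℕ → ℕ → Set
V p e n = Σ ℕ (λ r → (2 ≤ r) × S p e r n)

UEdge : ℕ → ℕ → ℕ → ℕ → Set
UEdge p e x y = V p e x × (y ≡ (x + p) ^ e)

DEdge : ℕ → ℕ → ℕ → ℕ → Set
DEdge p e x y = V p e y × (x ≡ y ^ e)

-- Two consecutive U-steps x → a → z followed by a D-step z → b force b = a + p, since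
-- z = (a + p)^e = b^e and e-th powers are injective. The next D-step b → y then makes
-- y^e = (x + p)^e + p, a number strictly between the consecutive e-th powers (x + p)^e
-- and (x + p + 1)^e, because 0 < p ≤ x + p and the gap between them exceeds x + p when e ≥ 2.
module Submission where

open import Defs
open import Data.Nat using (ℕ; _≤_)
open import Data.Nat.Primality using (Prime)
open import Data.Product using (Σ; _×_)
open import Relation.Nullary using (¬_)

open import Data.Nat using (suc; _+_; _*_; _^_; _<_; NonZero; >-nonZero; >-nonZero⁻¹; s≤s; z≤n)
open import Data.Nat.Properties
open import Data.Nat.Primality using (prime⇒nonZero)
open import Data.Product using (_,_)
open import Data.Sum using (inj₁; inj₂)
open import Data.Empty using (⊥-elim)
open import Relation.Binary using (tri<; tri≈; tri>)
open import Relation.Binary.PropositionalEquality using (_≡_; _≢_; sym; trans; cong)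

^-injectiveˡ : ∀ n .{{_ : NonZero n}} {x y : ℕ} → x ^ n ≡ y ^ n → x ≡ y
^-injectiveˡ n {x} {y} xⁿ≡yⁿ with <-cmp x y
... | tri< x<y _ _ = ⊥-elim (<-irrefl xⁿ≡yⁿ (^-monoˡ-< n x<y))
... | tri≈ _ x≡y _ = x≡y
... | tri> _ _ y<x = ⊥-elim (<-irrefl (sym xⁿ≡yⁿ) (^-monoˡ-< n y<x))

m≤m^[1+n] : ∀ m .{{_ : NonZero m}} n → m ≤ m ^ suc n
m≤m^[1+n] m n = begin
  m          ≡⟨ sym (*-identityʳ m) ⟩
  m * 1      ≤⟨ *-monoʳ-≤ m (m^n>0 m n) ⟩
  m * m ^ n  ∎
  where open ≤-Reasoning

m^n+m<[1+m]^n : ∀ {n} → 2 ≤ n → ∀ m → m ^ n + m < suc m ^ n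
m^n+m<[1+m]^n {suc (suc k)} (s≤s (s≤s _)) m = begin-strict
  m ^ suc (suc k) + m                   <⟨ +-monoʳ-< (m ^ suc (suc k)) (n<1+n m) ⟩
  m ^ suc (suc k) + suc m               ≡⟨ +-comm (m ^ suc (suc k)) (suc m) ⟩
  suc m + m * m ^ suc k                 ≤⟨ +-mono-≤ (m≤m^[1+n] (suc m) k)
                                                    (*-monoʳ-≤ m (^-monoˡ-≤ (suc k) (n≤1+n m))) ⟩
  suc m ^ suc k + m * suc m ^ suc k     ≡⟨⟩
  suc m ^ suc (suc k)                   ∎
  where open ≤-Reasoning

y^n≢c^n+d : ∀ {n} → 2 ≤ n → ∀ {c d} → 0 < d → d ≤ c → ∀ y → y ^ n ≢ c ^ n + d
y^n≢c^n+d {n} 2≤n {c} {d} 0<d d≤c y yⁿ≡cⁿ+d with ≤-<-connex y c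
... | inj₁ y≤c = <-irrefl yⁿ≡cⁿ+d (begin-strict
  y ^ n      ≤⟨ ^-monoˡ-≤ n y≤c ⟩
  c ^ n      <⟨ m<m+n (c ^ n) 0<d ⟩
  c ^ n + d  ∎)
  where open ≤-Reasoning
... | inj₂ c<y = <-irrefl (sym yⁿ≡cⁿ+d) (begin-strict
  c ^ n + d      ≤⟨ +-monoʳ-≤ (c ^ n) d≤c ⟩
  c ^ n + c      <⟨ m^n+m<[1+m]^n 2≤n c ⟩
  suc c ^ n      ≤⟨ ^-monoˡ-≤ n c<y ⟩
  y ^ n          ∎)
  where open ≤-Reasoning

theorem24 : (p e : ℕ) → Prime p → 2 ≤ e →
    ¬ (Σ ℕ λ x → Σ ℕ λ a → Σ ℕ λ z → Σ ℕ λ b → Σ ℕ λ y →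
         UEdge p e x a × UEdge p e a z × DEdge p e z b × DEdge p e b y)
theorem24 p e p-prime 2≤e (x , a , z , b , y , (_ , a≡) , (_ , z≡) , (_ , z≡bᵉ) , (_ , b≡yᵉ)) =
  y^n≢c^n+d 2≤e 0<p (m≤n+m p x) y yᵉ≡[x+p]ᵉ+p
  where
  instance
    _ = prime⇒nonZero p-prime
    _ = >-nonZero (≤-trans (s≤s z≤n) 2≤e)
  0<p : 0 < p
  0<p = >-nonZero⁻¹ p
  b≡a+p : b ≡ a + p
  b≡a+p = ^-injectiveˡ e (trans (sym z≡bᵉ) z≡)
  yᵉ≡[x+p]ᵉ+p : y ^ e ≡ (x + p) ^ e + p
  yᵉ≡[x+p]ᵉ+p = trans (sym b≡yᵉ) (trans b≡a+p (cong (_+ p) a≡))
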